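{- For every integer $n\ge3$, $\mathcal{M}_0(C_n)=\mathcal{M}_0(P_n)$, and this common value equals $\frac{n}{2}$ if $n\equiv0\pmod 4$, $\frac{n+2}{2}$ if $n\equiv2\pmod4$, and $\frac{n+1}{2}$ if $n\equiv1\pmod4$ or $n\equiv3\pmod4$.
   Context: All graphs are finite and simple; $C_n$ and $P_n$ are the cycle and path on $n$ vertices. For a vertex $v$, $\delta(v)$ is its degree and $\delta_X(v)=|N(v)\cap X|$. A nonempty set $M\subseteq V(G)$ is a $0$-monopoly if every vertex $v$ satisfies $\delta_M(v)\ge\frac{\delta(v)}{2}$; $\mathcal{M}_0(G)$ is the minimum cardinality of a $0$-monopoly. -}

module Defs where

open import Data.Nat using (ℕ; zero; suc; _+_; _*_; _≤_; _%_; _/_)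
open import Data.Nat.Properties using (_≟_)
open import Data.Fin using (Fin; toℕ)
open import Data.Bool using (Bool; true; false; _∧_; _∨_; T)
open import Data.List using (List; length; filter)
open import Data.List.Base using (allFin)
open import Data.Product using (Σ; ∃; _×_)
open import Relation.Nullary.Decidable using (⌊_⌋; does)
open import Relation.Binary.PropositionalEquality using (_≡_)
open import Relation.Unary using (Decidable)

-- A graph on vertex set Fin n, given by a Boolean adjacency relation.
-- (The two graphs used below, C_n and P_n for n ≥ 3, are symmetric and
-- loopless, i.e. finite simple graphs.)
Graph : ℕ → Set
Graph n = Fin n → Fin n → Bool

adj : ∀ {n} → Graph n → Fin n → Fin n → Bool
adj G = G

VSet : ℕ → Set
VSet n = Fin n → Bool

card : ∀ {n} → VSet n → ℕ
card {n} X = length (filter (λ v → T? (X v)) (allFin n))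
  where
  open import Data.Bool using (T?)

degIn : ∀ {n} → Graph n → VSet n → Fin n → ℕ
degIn G X v = card (λ u → adj G v u ∧ X u)

deg : ∀ {n} → Graph n → Fin n → ℕ
deg G v = degIn G (λ _ → true) v

-- M is a 0-monopoly: nonempty and δ_M(v) ≥ δ(v)/2 for every vertex v
-- (written without division as δ(v) ≤ 2 δ_M(v)).
IsZeroMonopoly : ∀ {n} → Graph n → VSet n → Set
IsZeroMonopoly {n} G M =
  (Σ (Fin n) λ v → T (M v)) × (∀ v → deg G v ≤ 2 * degIn G M v)

M₀≡ : ∀ {n} → Graph n → ℕ → Set
M₀≡ G k =
  (Σ _ λ M → IsZeroMonopoly G M × card M ≡ k)
  × (∀ M → IsZeroMonopoly G M → k ≤ card M)

pathAdj : ∀ {n} → Fin n → Fin n → Bool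
pathAdj i j = does (suc (toℕ i) ≟ toℕ j) ∨ does (suc (toℕ j) ≟ toℕ i)

cycleAdj : ∀ n → Fin n → Fin n → Bool
cycleAdj n i j =
  does ((suc (toℕ i) % suc n') ≟ toℕ j) ∨ does ((suc (toℕ j) % suc n') ≟ toℕ i)
  where
  n' : ℕ
  n' = Data.Nat.pred n
  -- note: used only for n ≥ 1, where suc (pred n) = n

C : ∀ n → Graph n
C n = cycleAdj n

P : ∀ n → Graph n
P n = pathAdj

value : ℕ → ℕ
value n with n % 4
... | 0 = n / 2
... | 2 = (n + 2) / 2
... | _ = (n + 1) / 2

-- In C_n and P_n every vertex has one or two neighbours, so the 0-monopolies are exactly the
-- total dominating sets (every vertex has a neighbour in M), and as P_n ⊆ C_n a total
-- dominating set of P_n is one of C_n. Vertex i is dominated only through i ± 1. For odd n,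
-- counting a dominating neighbour for each vertex gives n ≤ 2|M|. For n = 2k the odd vertices
-- are dominated only by even ones and vice versa, so M meets every pair {2j, 2j+2} and every
-- pair {2j+1, 2j+3} (indices mod n): a vertex cover of two k-cycles, and the same count
-- gives |M| ≥ 2⌈k/2⌉. Conversely, the vertices ≡ 1, 2 (mod 4) together with n − 2 totally
-- dominate P_n.

module Submission where

open import Defs
open import Data.Bool using (Bool; true; false; _∧_; _∨_; T; T?)
open import Data.Bool.Properties using (T-∧; T-∨; T-≡; ¬-not; ∨-identityʳ)
open import Data.Fin using (Fin; zero; suc; toℕ; fromℕ<)
open import Data.Fin.Properties using (toℕ<n; toℕ-fromℕ<)
open import Data.List using (length; filter; tabulate)
open import Data.Nat
  using (ℕ; zero; suc; pred; _+_; _*_; _≤_; _<_; z≤n; s≤s; s≤s⁻¹; z<s; s<s; _%_; _/_; _≡ᵇ_; ⌈_/2⌉)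
open import Data.Nat.DivMod using (m/n≡1+[m∸n]/n; [m+n]%n≡m%n; m<n⇒m%n≡m; n%n≡0; m%n<n)
open import Data.Nat.Properties
open import Algebra.Properties.CommutativeSemigroup +-commutativeSemigroup using (interchange)
open import Data.Product using (Σ; ∃; _×_; _,_; proj₁; proj₂)
open import Data.Sum using (_⊎_; inj₁; inj₂)
open import Data.Unit using (tt)
open import Function using (_∘_)
open import Function.Bundles using (Equivalence)
open import Relation.Binary.PropositionalEquality

open Equivalence using (to; from)

private
  variable
    m n i j k : ℕ
    f g : ℕ → Bool

double-suc : ∀ k → suc k + suc k ≡ suc (suc (k + k))
double-suc k = cong suc (+-suc k k)

-- Counting on initial segments of ℕ

bit : Bool → ℕ
bit true  = 1
bit false = 0

bit-mono : ∀ {a b} → (T a → T b) → bit a ≤ bit b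
bit-mono {false}         _   = z≤n
bit-mono {true}  {true}  _   = ≤-refl
bit-mono {true}  {false} a⇒b with () ← a⇒b tt

bit-∨ : ∀ a b → bit (a ∨ b) ≤ bit a + bit b
bit-∨ true  b = s≤s z≤n
bit-∨ false b = ≤-refl

count : ℕ → (ℕ → Bool) → ℕ
count zero    f = 0
count (suc n) f = bit (f 0) + count n (f ∘ suc)

count-cong : ∀ n → (∀ i → i < n → f i ≡ g i) → count n f ≡ count n g
count-cong zero    f≡g = refl
count-cong (suc n) f≡g =
  cong₂ _+_ (cong bit (f≡g 0 z<s)) (count-cong n λ i i<n → f≡g (suc i) (s<s i<n))

count-mono : ∀ n → (∀ i → i < n → T (f i) → T (g i)) → count n f ≤ count n g
count-mono zero    f⇒g = z≤n
count-mono (suc n) f⇒g =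
  +-mono-≤ (bit-mono (f⇒g 0 z<s)) (count-mono n λ i i<n → f⇒g (suc i) (s<s i<n))

count-∨ : ∀ n → count n (λ i → f i ∨ g i) ≤ count n f + count n g
count-∨ zero = z≤n
count-∨ {f} {g} (suc n) = begin
  bit (f 0 ∨ g 0) + count n (λ i → f (suc i) ∨ g (suc i))
    ≤⟨ +-mono-≤ (bit-∨ (f 0) (g 0)) (count-∨ n) ⟩
  (bit (f 0) + bit (g 0)) + (count n (f ∘ suc) + count n (g ∘ suc))
    ≡⟨ interchange (bit (f 0)) (bit (g 0)) _ _ ⟩
  (bit (f 0) + count n (f ∘ suc)) + (bit (g 0) + count n (g ∘ suc)) ∎
  where open ≤-Reasoning

count-all : ∀ n → (∀ i → i < n → T (f i)) → count n f ≡ n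
count-all zero    all = refl
count-all {f} (suc n) all with f 0 | all 0 z<s
... | true | _ = cong suc (count-all n λ i i<n → all (suc i) (s<s i<n))

count-snoc : ∀ n f → count (suc n) f ≡ count n f + bit (f n)
count-snoc zero    f = +-comm (bit (f 0)) 0
count-snoc (suc n) f =
  trans (cong (bit (f 0) +_) (count-snoc n (f ∘ suc))) (sym (+-assoc (bit (f 0)) _ _))

count-pos : ∀ n → i < n → T (f i) → 1 ≤ count n f
count-pos {zero}  {f} (suc n) _ fi with f 0
... | true = s≤s z≤n
count-pos {suc i} {f} (suc n) (s<s i<n) fi =
  ≤-trans (count-pos n i<n fi) (m≤n+m _ (bit (f 0)))

count-witness : ∀ n → 1 ≤ count n f → ∃ λ i → i < n × T (f i)
count-witness {f} (suc n) pos with f 0 in f0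
... | true  = 0 , z<s , subst T (sym f0) tt
... | false with count-witness n pos
...   | i , i<n , fi = suc i , s<s i<n , fi

count-≡ᵇ : ∀ n a → count n (_≡ᵇ a) ≤ 1
count-≡ᵇ zero    a       = z≤n
count-≡ᵇ (suc n) zero    = s≤s (≤-reflexive (count-all-false n))
  where
  count-all-false : ∀ n → count n (λ _ → false) ≡ 0
  count-all-false zero    = refl
  count-all-false (suc n) = count-all-false n
count-≡ᵇ (suc n) (suc a) = count-≡ᵇ n a

count-interleave : ∀ k f →
  count (k + k) f ≡ count k (λ j → f (j + j)) + count k (λ j → f (suc (j + j)))
count-interleave zero    f = refl
count-interleave (suc k) f = begin
  count (suc k + suc k) f
    ≡⟨ cong (λ n → count n f) (double-suc k) ⟩
  bit (f 0) + (bit (f 1) + count (k + k) (λ i → f (suc (suc i))))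
    ≡⟨ cong (λ c → bit (f 0) + (bit (f 1) + c))
            (count-interleave k (λ i → f (suc (suc i)))) ⟩
  bit (f 0) + (bit (f 1) + (count k evens⁺ + count k odds⁺))
    ≡⟨ sym (+-assoc (bit (f 0)) (bit (f 1)) _) ⟩
  (bit (f 0) + bit (f 1)) + (count k evens⁺ + count k odds⁺)
    ≡⟨ interchange (bit (f 0)) (bit (f 1)) _ _ ⟩
  (bit (f 0) + count k evens⁺) + (bit (f 1) + count k odds⁺)
    ≡⟨ sym (cong₂ (λ a b → (bit (f 0) + a) + (bit (f 1) + b))
             (count-cong k λ j _ → cong f (double-suc j))
             (count-cong k λ j _ → cong (f ∘ suc) (double-suc j))) ⟩
  count (suc k) (λ j → f (j + j)) + count (suc k) (λ j → f (suc (j + j))) ∎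
  where
  open ≡-Reasoning
  evens⁺ odds⁺ : ℕ → Bool
  evens⁺ j = f (suc (suc (j + j)))
  odds⁺  j = f (suc (suc (suc (j + j))))

/2-+4 : ∀ k → (4 + k) / 2 ≡ 2 + k / 2
/2-+4 k = trans (m/n≡1+[m∸n]/n {4 + k} {2} (s≤s (s≤s z≤n)))
                (cong suc (m/n≡1+[m∸n]/n {2 + k} {2} (s≤s (s≤s z≤n))))

value-+4 : ∀ n → value (4 + n) ≡ 2 + value n
value-+4 n with (4 + n) % 4 | n % 4 | trans (cong (_% 4) (+-comm 4 n)) ([m+n]%n≡m%n n 4)
... | _ | 0                 | refl = /2-+4 n
... | _ | 1                 | refl = /2-+4 (n + 1)
... | _ | 2                 | refl = /2-+4 (n + 2)
... | _ | suc (suc (suc _)) | refl = /2-+4 (n + 1)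

value-odd : ∀ k → value (suc (k + k)) ≡ suc k
value-odd 0 = refl
value-odd 1 = refl
value-odd (suc (suc k)) = begin
  value (suc (suc (suc k) + suc (suc k)))  ≡⟨ cong (value ∘ suc) (double-suc (suc k)) ⟩
  value (3 + (suc k + suc k))              ≡⟨ cong (value ∘ (3 +_)) (double-suc k) ⟩
  value (4 + suc (k + k))                  ≡⟨ value-+4 (suc (k + k)) ⟩
  2 + value (suc (k + k))                  ≡⟨ cong (2 +_) (value-odd k) ⟩
  suc (suc (suc k))                        ∎
  where open ≡-Reasoning

value-even : ∀ k → value (k + k) ≡ ⌈ k /2⌉ + ⌈ k /2⌉
value-even 0 = refl
value-even 1 = refl
value-even (suc (suc k)) = begin
  value (suc (suc k) + suc (suc k))  ≡⟨ cong value (double-suc (suc k)) ⟩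
  value (2 + (suc k + suc k))        ≡⟨ cong (value ∘ (2 +_)) (double-suc k) ⟩
  value (4 + (k + k))                ≡⟨ value-+4 (k + k) ⟩
  2 + value (k + k)                  ≡⟨ cong (2 +_) (value-even k) ⟩
  2 + (⌈ k /2⌉ + ⌈ k /2⌉)            ≡⟨ sym (double-suc ⌈ k /2⌉) ⟩
  suc ⌈ k /2⌉ + suc ⌈ k /2⌉          ∎
  where open ≡-Reasoning

-- Double counting on cycles

double-count : ∀ n (σ : ℕ → ℕ) → (∀ i → i < n → T (f i) ⊎ T (f (σ i))) →
  count n (f ∘ σ) ≡ count n f → n ≤ count n f + count n f
double-count {f} n σ cover rotation = begin
  n                              ≡⟨ sym (count-all n λ i i<n → T-∨ .from (cover i i<n)) ⟩
  count n (λ i → f i ∨ f (σ i))  ≤⟨ count-∨ n ⟩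
  count n f + count n (f ∘ σ)    ≡⟨ cong (count n f +_) rotation ⟩
  count n f + count n f          ∎
  where open ≤-Reasoning

⌈/2⌉≤ : n ≤ k + k → ⌈ n /2⌉ ≤ k
⌈/2⌉≤ {k = k} n≤2k = ≤-trans (⌈n/2⌉-mono n≤2k) (≤-reflexive (sym (n≡⌈n+n/2⌉ k)))

-- Successor on ℤ/(1+m), as in the adjacency of C, and its inverse.
next : ℕ → ℕ → ℕ
next m i = suc i % suc m

prev : ℕ → ℕ → ℕ
prev m zero    = m
prev m (suc i) = i

next-< : i < m → next m i ≡ suc i
next-< i<m = m<n⇒m%n≡m (s<s i<m)

next-last : ∀ m → next m m ≡ 0
next-last m = n%n≡0 (suc m)

next≤ : ∀ m i → next m i ≤ m
next≤ m i = s≤s⁻¹ (m%n<n (suc i) (suc m))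

next≡⇒≡prev : i ≤ m → next m i ≡ j → i ≡ prev m j
next≡⇒≡prev {i} {m} i≤m refl with m≤n⇒m<n∨m≡n i≤m
... | inj₁ i<m = cong (prev m) (sym (next-< i<m))
... | inj₂ refl = cong (prev m) (sym (next-last m))

count-∘next : ∀ m f → count (suc m) (f ∘ next m) ≡ count (suc m) f
count-∘next m f = begin
  count (suc m) (f ∘ next m)            ≡⟨ count-snoc m (f ∘ next m) ⟩
  count m (f ∘ next m) + bit (f (next m m))
    ≡⟨ cong₂ _+_ (count-cong m λ i i<m → cong f (next-< i<m))
                 (cong (bit ∘ f) (next-last m)) ⟩
  count m (λ i → f (suc i)) + bit (f 0) ≡⟨ +-comm _ (bit (f 0)) ⟩
  count (suc m) f                       ∎
  where open ≡-Reasoning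

cycle-cover-lb : ∀ m → (∀ i → i ≤ m → T (f i) ⊎ T (f (next m i))) →
  ⌈ suc m /2⌉ ≤ count (suc m) f
cycle-cover-lb {f} m cover =
  ⌈/2⌉≤ (double-count (suc m) (next m) (λ i i≤m → cover i (s≤s⁻¹ i≤m))
          (count-∘next m f))

-- F totally dominates C_(1+m): the vertex next m i has a neighbour,
-- i or next m (next m i), in F.
TotallyDominatesCycle : ℕ → (ℕ → Bool) → Set
TotallyDominatesCycle m F = ∀ i → i ≤ m → T (F i) ⊎ T (F (next m (next m i)))

totallyDominatesCycle-lb : ∀ m {F} → TotallyDominatesCycle m F →
  ⌈ suc m /2⌉ ≤ count (suc m) F
totallyDominatesCycle-lb m {F} dom =
  ⌈/2⌉≤ (double-count (suc m) (next m ∘ next m) (λ i i≤m → dom i (s≤s⁻¹ i≤m))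
          (trans (count-∘next m (F ∘ next m)) (count-∘next m F)))

next²-evens : ∀ k → j ≤ k →
  next (suc (k + k)) (next (suc (k + k)) (j + j)) ≡ next k j + next k j
next²-evens {j} k j≤k with m≤n⇒m<n∨m≡n j≤k
... | inj₁ j<k = begin
  next N (next N (j + j))   ≡⟨ cong (next N) (next-< (s≤s (+-mono-≤ j≤k j≤k))) ⟩
  next N (suc (j + j))      ≡⟨ next-< (s≤s (+-mono-< j<k j<k)) ⟩
  suc (suc (j + j))         ≡⟨ sym (double-suc j) ⟩
  suc j + suc j             ≡⟨ sym (cong₂ _+_ (next-< j<k) (next-< j<k)) ⟩
  next k j + next k j       ∎
  where open ≡-Reasoning; N = suc (k + k)
... | inj₂ refl = begin
  next N (next N (k + k))   ≡⟨ cong (next N) (next-< (n<1+n (k + k))) ⟩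
  next N N                  ≡⟨ next-last N ⟩
  0                         ≡⟨ sym (cong₂ _+_ (next-last k) (next-last k)) ⟩
  next k k + next k k       ∎
  where open ≡-Reasoning; N = suc (k + k)

next²-odds : ∀ k → j ≤ k →
  next (suc (k + k)) (next (suc (k + k)) (suc (j + j))) ≡ suc (next k j + next k j)
next²-odds {j} k j≤k with m≤n⇒m<n∨m≡n j≤k
... | inj₁ j<k = begin
  next N (next N (suc (j + j)))  ≡⟨ cong (next N) (next-< (s≤s (+-mono-< j<k j<k))) ⟩
  next N (suc (suc (j + j)))
    ≡⟨ next-< (s≤s (≤-trans (≤-reflexive (sym (double-suc j))) (+-mono-≤ j<k j<k))) ⟩
  suc (suc (suc (j + j)))        ≡⟨ sym (cong suc (double-suc j)) ⟩
  suc (suc j + suc j)            ≡⟨ sym (cong suc (cong₂ _+_ (next-< j<k) (next-< j<k))) ⟩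
  suc (next k j + next k j)      ∎
  where open ≡-Reasoning; N = suc (k + k)
... | inj₂ refl = begin
  next N (next N N)              ≡⟨ cong (next N) (next-last N) ⟩
  next N 0                       ≡⟨ next-< {m = N} z<s ⟩
  1                              ≡⟨ sym (cong suc (cong₂ _+_ (next-last k) (next-last k))) ⟩
  suc (next k k + next k k)      ∎
  where open ≡-Reasoning; N = suc (k + k)

data EvenOdd : ℕ → Set where
  even : ∀ k → EvenOdd (k + k)
  odd  : ∀ k → EvenOdd (suc (k + k))

evenOdd : ∀ n → EvenOdd n
evenOdd zero = even 0
evenOdd (suc n) with evenOdd n
... | even k = odd k
... | odd k  = subst EvenOdd (double-suc k) (even (suc k))

cycle-lb-odd : ∀ k {F} → TotallyDominatesCycle (k + k) F →
  value (suc (k + k)) ≤ count (suc (k + k)) F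
cycle-lb-odd k {F} dom = begin
  value (suc (k + k))       ≡⟨ value-odd k ⟩
  suc k                     ≡⟨ cong suc (n≡⌊n+n/2⌋ k) ⟩
  ⌈ suc (k + k) /2⌉         ≤⟨ totallyDominatesCycle-lb (k + k) dom ⟩
  count (suc (k + k)) F     ∎
  where open ≤-Reasoning

cycle-lb-even : ∀ k {F} → TotallyDominatesCycle (suc (k + k)) F →
  value (suc k + suc k) ≤ count (suc k + suc k) F
cycle-lb-even k {F} dom = begin
  value (suc k + suc k)                        ≡⟨ value-even (suc k) ⟩
  ⌈ suc k /2⌉ + ⌈ suc k /2⌉                    ≤⟨ +-mono-≤ (cycle-cover-lb k evens-cover)
                                                            (cycle-cover-lb k odds-cover) ⟩
  count (suc k) evens + count (suc k) odds     ≡⟨ sym (count-interleave (suc k) F) ⟩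
  count (suc k + suc k) F                      ∎
  where
  open ≤-Reasoning
  evens odds : ℕ → Bool
  evens j = F (j + j)
  odds  j = F (suc (j + j))
  evens-cover : ∀ j → j ≤ k → T (evens j) ⊎ T (evens (next k j))
  evens-cover j j≤k = subst (λ i → T (evens j) ⊎ T (F i)) (next²-evens k j≤k)
    (dom (j + j) (≤-trans (+-mono-≤ j≤k j≤k) (n≤1+n (k + k))))
  odds-cover : ∀ j → j ≤ k → T (odds j) ⊎ T (odds (next k j))
  odds-cover j j≤k = subst (λ i → T (odds j) ⊎ T (F i)) (next²-odds k j≤k)
    (dom (suc (j + j)) (s≤s (+-mono-≤ j≤k j≤k)))

cycle-lb : ∀ m {F} → TotallyDominatesCycle m F → value (suc m) ≤ count (suc m) F
cycle-lb m {F} dom with evenOdd m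
... | even k = cycle-lb-odd k dom
... | odd k  = subst (λ n → value n ≤ count n F) (double-suc k) (cycle-lb-even k dom)

-- A total dominating set of the path

stripe : ℕ → Bool
stripe 0 = false
stripe 1 = true
stripe 2 = true
stripe 3 = false
stripe (suc (suc (suc (suc i)))) = stripe i

stripe-neighbour : ∀ i → T (stripe (suc i)) ⊎ ∃ λ j → suc j ≡ i × T (stripe j)
stripe-neighbour 0 = inj₁ tt
stripe-neighbour 1 = inj₁ tt
stripe-neighbour 2 = inj₂ (1 , refl , tt)
stripe-neighbour 3 = inj₂ (2 , refl , tt)
stripe-neighbour (suc (suc (suc (suc i)))) with stripe-neighbour i
... | inj₁ t            = inj₁ t
... | inj₂ (j , refl , t) = inj₂ (4 + j , refl , t)

count-stripe : ∀ m → count m stripe + 1 + bit (stripe (suc m)) ≡ value (2 + m)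
count-stripe 0 = refl
count-stripe 1 = refl
count-stripe 2 = refl
count-stripe 3 = refl
count-stripe (suc (suc (suc (suc m)))) =
  trans (cong (2 +_) (count-stripe m)) (sym (value-+4 (2 + m)))

-- On the path with 2+m vertices, the last vertex m+1 needs m in the set.
pathTDS : ℕ → ℕ → Bool
pathTDS m i = stripe i ∨ (i ≡ᵇ m)

pathTDS-≢ : i ≢ m → pathTDS m i ≡ stripe i
pathTDS-≢ {i} {m} i≢m =
  trans (cong (stripe i ∨_) (¬-not λ eq → i≢m (≡ᵇ⇒≡ i m (T-≡ .from eq)))) (∨-identityʳ _)

pathTDS-at : ∀ m → T (pathTDS m m)
pathTDS-at m = T-∨ .from (inj₂ (≡⇒≡ᵇ m m refl))

count-pathTDS : ∀ m → count (2 + m) (pathTDS m) ≡ value (2 + m)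
count-pathTDS m = begin
  count (2 + m) S                         ≡⟨ count-snoc (suc m) S ⟩
  count (suc m) S + bit (S (suc m))       ≡⟨ cong (_+ bit (S (suc m))) (count-snoc m S) ⟩
  count m S + bit (S m) + bit (S (suc m))
    ≡⟨ cong₂ (λ c b → c + b + bit (S (suc m)))
             (count-cong m λ i → pathTDS-≢ ∘ <⇒≢)
             (cong bit (T-≡ .to (pathTDS-at m))) ⟩
  count m stripe + 1 + bit (S (suc m))
    ≡⟨ cong (λ b → count m stripe + 1 + bit b) (pathTDS-≢ {m = m} 1+n≢n) ⟩
  count m stripe + 1 + bit (stripe (suc m)) ≡⟨ count-stripe m ⟩
  value (2 + m)                           ∎
  where open ≡-Reasoning; S = pathTDS m

-- Vertex sets as sequences

extend : ∀ {n} → VSet n → ℕ → Bool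
extend {zero}  X i       = false
extend {suc n} X zero    = X zero
extend {suc n} X (suc i) = extend (X ∘ suc) i

extend-toℕ : ∀ {n} (X : VSet n) u → extend X (toℕ u) ≡ X u
extend-toℕ X zero    = refl
extend-toℕ X (suc u) = extend-toℕ (X ∘ suc) u

extend-fromℕ< : ∀ {n} (X : VSet n) (i<n : i < n) → extend X i ≡ X (fromℕ< i<n)
extend-fromℕ< X i<n = trans (cong (extend X) (sym (toℕ-fromℕ< i<n))) (extend-toℕ X _)

card-tabulate : ∀ {n} m (h : Fin m → Fin n) (X : VSet n) →
  length (filter (λ v → T? (X v)) (tabulate h)) ≡ count m (extend (X ∘ h))
card-tabulate zero    h X = refl
card-tabulate (suc m) h X with X (h zero)
... | true  = cong suc (card-tabulate m (h ∘ suc) X)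
... | false = card-tabulate m (h ∘ suc) X

card≡count : ∀ {n} (X : VSet n) → card X ≡ count n (extend X)
card≡count {n} X = card-tabulate n (λ v → v) X

card-∘toℕ : ∀ n f → card {n} (f ∘ toℕ) ≡ count n f
card-∘toℕ n f = trans (card≡count {n} (f ∘ toℕ)) (count-cong n λ i i<n →
  trans (extend-fromℕ< {n = n} (f ∘ toℕ) i<n) (cong f (toℕ-fromℕ< i<n)))

card-pos : ∀ {n} (X : VSet n) u → T (X u) → 1 ≤ card X
card-pos {n} X u Xu = subst (1 ≤_) (sym (card≡count X))
  (count-pos n (toℕ<n u) (subst T (sym (extend-toℕ X u)) Xu))

card-witness : ∀ {n} (X : VSet n) → 1 ≤ card X → ∃ λ u → T (X u)
card-witness {n} X pos with count-witness n (subst (1 ≤_) (card≡count X) pos)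
... | i , i<n , t = fromℕ< i<n , subst T (extend-fromℕ< X i<n) t

card≤2 : ∀ {n} (X : VSet n) a b → (∀ u → T (X u) → toℕ u ≡ a ⊎ toℕ u ≡ b) →
  card X ≤ 2
card≤2 {n} X a b ⊆ab = begin
  card X                                  ≡⟨ card≡count X ⟩
  count n (extend X)                      ≤⟨ count-mono n into-ab ⟩
  count n (λ i → (i ≡ᵇ a) ∨ (i ≡ᵇ b))     ≤⟨ count-∨ n ⟩
  count n (_≡ᵇ a) + count n (_≡ᵇ b)       ≤⟨ +-mono-≤ (count-≡ᵇ n a) (count-≡ᵇ n b) ⟩
  2                                       ∎
  where
  open ≤-Reasoning
  into-ab : ∀ i → i < n → T (extend X i) → T ((i ≡ᵇ a) ∨ (i ≡ᵇ b))
  into-ab i i<n t with ⊆ab (fromℕ< i<n) (subst T (extend-fromℕ< X i<n) t)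
  ... | inj₁ e = T-∨ .from (inj₁ (≡⇒≡ᵇ i a (trans (sym (toℕ-fromℕ< i<n)) e)))
  ... | inj₂ e = T-∨ .from (inj₂ (≡⇒≡ᵇ i b (trans (sym (toℕ-fromℕ< i<n)) e)))

-- Total domination and 0-monopolies

TotallyDominates : ∀ {n} → Graph n → VSet n → Set
TotallyDominates {n} G M = ∀ v → Σ (Fin n) λ u → T (adj G v u) × T (M u)

monopoly⇒totallyDominates : ∀ {n} {G : Graph n} {M : VSet n} →
  (∀ v → ∃ λ u → T (adj G v u)) → IsZeroMonopoly G M → TotallyDominates G M
monopoly⇒totallyDominates {G = G} {M} neighbour (_ , monopoly) v
  with card-witness (λ u → adj G v u ∧ M u) (half-pos (≤-trans deg-pos (monopoly v)))
  where
  half-pos : ∀ {d} → 1 ≤ 2 * d → 1 ≤ d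
  half-pos {suc d} _ = s≤s z≤n
  deg-pos : 1 ≤ deg G v
  deg-pos = card-pos _ (proj₁ (neighbour v)) (T-∧ .from (proj₂ (neighbour v) , tt))
... | u , t = u , T-∧ .to t

totallyDominates⇒monopoly : ∀ {n} {G : Graph n} {M : VSet n} →
  Fin n → (∀ v → deg G v ≤ 2) → TotallyDominates G M → IsZeroMonopoly G M
totallyDominates⇒monopoly {G = G} {M} v₀ deg≤2 dom =
    (proj₁ (dom v₀) , proj₂ (proj₂ (dom v₀)))
  , λ v → let (u , Gvu , Mu) = dom v in
      ≤-trans (deg≤2 v)
        (*-monoʳ-≤ 2 (card-pos (λ u → adj G v u ∧ M u) u (T-∧ .from (Gvu , Mu))))

M₀≡-by-totalDomination : ∀ {n} {G : Graph n} {k} (D : VSet n) → Fin n →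
  (∀ v → ∃ λ u → T (adj G v u)) → (∀ v → deg G v ≤ 2) →
  TotallyDominates G D → card D ≡ k → (∀ M → TotallyDominates G M → k ≤ card M) →
  M₀≡ G k
M₀≡-by-totalDomination D v₀ neighbour deg≤2 dom card≡k minimal =
    (D , totallyDominates⇒monopoly v₀ deg≤2 dom , card≡k)
  , λ M monopoly → minimal M (monopoly⇒totallyDominates neighbour monopoly)

P-adj⇒ : ∀ {n} (v u : Fin n) → T (P n v u) →
  toℕ u ≡ suc (toℕ v) ⊎ suc (toℕ u) ≡ toℕ v
P-adj⇒ v u t with T-∨ .to t
... | inj₁ e = inj₁ (sym (≡ᵇ⇒≡ (suc (toℕ v)) (toℕ u) e))
... | inj₂ e = inj₂ (≡ᵇ⇒≡ (suc (toℕ u)) (toℕ v) e)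

P-adj⇐ : ∀ {n} (v u : Fin n) → toℕ u ≡ suc (toℕ v) ⊎ suc (toℕ u) ≡ toℕ v →
  T (P n v u)
P-adj⇐ v u (inj₁ e) = T-∨ .from (inj₁ (≡⇒≡ᵇ _ _ (sym e)))
P-adj⇐ v u (inj₂ e) = T-∨ .from (inj₂ (≡⇒≡ᵇ _ _ e))

C-adj⇒ : ∀ {m} (v u : Fin (suc m)) → T (C (suc m) v u) →
  toℕ u ≡ next m (toℕ v) ⊎ toℕ u ≡ prev m (toℕ v)
C-adj⇒ {m} v u t with T-∨ .to t
... | inj₁ e = inj₁ (sym (≡ᵇ⇒≡ (next m (toℕ v)) (toℕ u) e))
... | inj₂ e = inj₂ (next≡⇒≡prev (s≤s⁻¹ (toℕ<n u)) (≡ᵇ⇒≡ (next m (toℕ u)) (toℕ v) e))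

suc≡⇒next≡ : ∀ {m} (a b : Fin (suc m)) → suc (toℕ a) ≡ toℕ b → next m (toℕ a) ≡ toℕ b
suc≡⇒next≡ {m} a b e = trans (next-< (subst (_≤ m) (sym e) (s≤s⁻¹ (toℕ<n b)))) e

P⊆C : ∀ {m} (v u : Fin (suc m)) → T (P (suc m) v u) → T (C (suc m) v u)
P⊆C {m} v u t with P-adj⇒ v u t
... | inj₁ e = T-∨ .from (inj₁ (≡⇒≡ᵇ _ _ (suc≡⇒next≡ v u (sym e))))
... | inj₂ e = T-∨ .from (inj₂ (≡⇒≡ᵇ _ _ (suc≡⇒next≡ u v e)))


P-neighbour : ∀ {n} → 2 ≤ n → ∀ (v : Fin n) → ∃ λ u → T (P n v u)
P-neighbour {n} 2≤n v = let (u , e) = neighbour (toℕ v) (toℕ<n v) in u , P-adj⇐ v u e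
  where
  neighbour : ∀ i → i < n → ∃ λ (u : Fin n) → toℕ u ≡ suc i ⊎ suc (toℕ u) ≡ i
  neighbour zero    _    = fromℕ< 2≤n , inj₁ (toℕ-fromℕ< 2≤n)
  neighbour (suc i) i<n  = fromℕ< (<⇒≤ i<n) , inj₂ (cong suc (toℕ-fromℕ< (<⇒≤ i<n)))

deg-C≤2 : ∀ m (v : Fin (suc m)) → deg (C (suc m)) v ≤ 2
deg-C≤2 m v = card≤2 (λ u → C (suc m) v u ∧ true) (next m (toℕ v)) (prev m (toℕ v))
  λ u t → C-adj⇒ v u (proj₁ (T-∧ .to t))

deg-P≤2 : ∀ n (v : Fin n) → deg (P n) v ≤ 2
deg-P≤2 n v = card≤2 (λ u → P n v u ∧ true) (suc (toℕ v)) (pred (toℕ v))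
  λ u t → case (P-adj⇒ v u (proj₁ (T-∧ .to t)))
  where
  case : ∀ {u} → u ≡ suc (toℕ v) ⊎ suc u ≡ toℕ v → u ≡ suc (toℕ v) ⊎ u ≡ pred (toℕ v)
  case (inj₁ e) = inj₁ e
  case (inj₂ e) = inj₂ (cong pred e)

extend-∈ : ∀ {n} {X : VSet n} {u} → T (X u) → toℕ u ≡ i → T (extend X i)
extend-∈ {X = X} {u} t refl = subst T (sym (extend-toℕ X u)) t

totallyDominates⇒cycle : ∀ m {M : VSet (suc m)} →
  TotallyDominates (C (suc m)) M → TotallyDominatesCycle m (extend M)
totallyDominates⇒cycle m {M} dom i i≤m =
  let (u , v~u , Mu) = dom v in in-M Mu (C-adj⇒ v u v~u)
  where
  v : Fin (suc m)
  v = fromℕ< (s≤s (next≤ m i))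
  toℕ-v : toℕ v ≡ next m i
  toℕ-v = toℕ-fromℕ< (s≤s (next≤ m i))
  in-M : ∀ {u} → T (M u) → toℕ u ≡ next m (toℕ v) ⊎ toℕ u ≡ prev m (toℕ v) →
         T (extend M i) ⊎ T (extend M (next m (next m i)))
  in-M Mu (inj₁ e) = inj₂ (extend-∈ Mu (trans e (cong (next m) toℕ-v)))
  in-M Mu (inj₂ e) = inj₁ (extend-∈ Mu
    (trans e (trans (cong (prev m) toℕ-v) (sym (next≡⇒≡prev i≤m refl)))))

P⊆C-totallyDominates : ∀ {m} {M : VSet (suc m)} →
  TotallyDominates (P (suc m)) M → TotallyDominates (C (suc m)) M
P⊆C-totallyDominates dom v = let (u , u~v , Mu) = dom v in u , P⊆C v u u~v , Mu

C-totallyDominates-lb : ∀ m (M : VSet (suc m)) →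
  TotallyDominates (C (suc m)) M → value (suc m) ≤ card M
C-totallyDominates-lb m M dom = subst (value (suc m) ≤_) (sym (card≡count M))
  (cycle-lb m (totallyDominates⇒cycle m dom))

pathTDS-neighbour : ∀ m i → i < 2 + m →
  (suc i < 2 + m × T (pathTDS m (suc i))) ⊎ ∃ λ j → suc j ≡ i × T (pathTDS m j)
pathTDS-neighbour m i i<2+m with m≤n⇒m<n∨m≡n (s≤s⁻¹ i<2+m)
... | inj₂ refl = inj₂ (m , refl , pathTDS-at m)
... | inj₁ i≤m with stripe-neighbour i
...   | inj₁ t           = inj₁ (s≤s i≤m , T-∨ .from (inj₁ t))
...   | inj₂ (j , e , t) = inj₂ (j , e , T-∨ .from (inj₁ t))

pathTDS-totallyDominates : ∀ m → TotallyDominates (P (2 + m)) (pathTDS m ∘ toℕ)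
pathTDS-totallyDominates m v with pathTDS-neighbour m (toℕ v) (toℕ<n v)
... | inj₁ (i<n , t) =
    fromℕ< i<n
  , P-adj⇐ v _ (inj₁ (toℕ-fromℕ< i<n))
  , subst (T ∘ pathTDS m) (sym (toℕ-fromℕ< i<n)) t
... | inj₂ (j , e , t) =
    fromℕ< j<n
  , P-adj⇐ v _ (inj₂ (trans (cong suc (toℕ-fromℕ< j<n)) e))
  , subst (T ∘ pathTDS m) (sym (toℕ-fromℕ< j<n)) t
  where
  j<n : j < 2 + m
  j<n = <-trans (n<1+n j) (subst (_< 2 + m) (sym e) (toℕ<n v))

proposition15 : ∀ (n : ℕ) → 3 ≤ n → M₀≡ (C n) (value n) × M₀≡ (P n) (value n)
proposition15 1 (s≤s ())
proposition15 (suc (suc k)) _ =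
    M₀≡-by-totalDomination D zero C-neighbour (deg-C≤2 (suc k))
      (P⊆C-totallyDominates D-dominates) card-D (C-totallyDominates-lb (suc k))
  , M₀≡-by-totalDomination D zero (P-neighbour 2≤2+k) (deg-P≤2 (2 + k))
      D-dominates card-D (λ M → C-totallyDominates-lb (suc k) M ∘ P⊆C-totallyDominates)
  where
  2≤2+k : 2 ≤ 2 + k
  2≤2+k = s≤s (s≤s z≤n)
  D : VSet (2 + k)
  D = pathTDS k ∘ toℕ
  D-dominates : TotallyDominates (P (2 + k)) D
  D-dominates = pathTDS-totallyDominates k
  card-D : card D ≡ value (2 + k)
  card-D = trans (card-∘toℕ (2 + k) (pathTDS k)) (count-pathTDS k)
  C-neighbour : ∀ v → ∃ λ u → T (C (2 + k) v u)
  C-neighbour v = let (u , u~v) = P-neighbour 2≤2+k v in u , P⊆C v u u~v
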